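{- Let $F_c$ be a finite union-closed family of finite sets. Suppose there exist finite families $F_0,\ldots,F_k$ and natural numbers $c_0,\ldots,c_k$ such that (1) for every $0\le i\le k$, $F_i\in \mathrm{uce}(F_c)$; (2) for every $a\in\bigcup F_c$, $\sum_{i=0}^k c_i\cdot\bigl(2\cdot \mathrm{cnt}(a,F_i)-|F_i|\bigr)<0$ (computed in the integers); (3) $c_i>0$ for some $0\le i\le k$. Then $F_c$ is not an FC-family.
   Context: All sets and families are finite. A family $F$ is union-closed if $A\cup B\in F$ for all $A,B\in F$. A family $F$ is union-closed for $F_c$ if $F$ is union-closed and $A\cup B\in F$ for all $A\in F$, $B\in F_c$. The collection of union-closed extensions of $F_c$ is $\mathrm{uce}(F_c)=\{F : F\subseteq \mathcal{P}(\bigcup F_c) \text{ and } F \text{ is union-closed for } F_c\}$, where $\mathcal{P}$ denotes the power set. For an element $a$ and family $F$, $\mathrm{cnt}(a,F)=|\{A\in F: a\in A\}|$. A family $F_c$ is an FC-family if for every (finite) union-closed family $F\supseteq F_c$ there is an element $a\in\bigcup F_c$ with $2\cdot\mathrm{cnt}(a,F)\ge |F|$; otherwise it is a nonFC-family. -}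

module Defs where

open import Data.Nat using (ℕ; _≤_; _*_; _<_)
open import Data.Nat.Properties using (_≟_)
open import Data.Integer as ℤ using (ℤ; +_)
open import Data.List using (List; length; filter; _++_; map; foldr)
open import Data.List.Base using (allFin)
open import Data.List.Membership.Propositional using (_∈_)
open import Data.List.Membership.DecPropositional _≟_ using (_∈?_)
open import Data.List.Relation.Unary.Any using (Any)
open import Data.List.Relation.Unary.AllPairs using (AllPairs)
open import Data.Fin using (Fin)
open import Data.Product using (Σ; _×_; ∃)
open import Relation.Nullary using (¬_)

-- Ground elements are natural numbers (w.l.o.g.: every finite family
-- lives over a countable ground set).  A finite set is given by a list
-- of its elements (duplicates / order irrelevant); sets are compared
-- extensionally.
FSet : Set
FSet = List ℕ

_≐_ : FSet → FSet → Set
A ≐ B = ∀ x → (x ∈ A → x ∈ B) × (x ∈ B → x ∈ A)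

_∪_ : FSet → FSet → FSet
A ∪ B = A ++ B

Family : Set
Family = List FSet

Distinct : Family → Set
Distinct F = AllPairs (λ A B → ¬ (A ≐ B)) F

_∈F_ : FSet → Family → Set
A ∈F F = Any (λ B → A ≐ B) F

-- |F|  (meaningful for Distinct families)
card : Family → ℕ
card F = length F

_∈⋃_ : ℕ → Family → Set
a ∈⋃ F = Any (λ A → a ∈ A) F

cnt : ℕ → Family → ℕ
cnt a F = length (filter (λ A → a ∈? A) F)

UnionClosed : Family → Set
UnionClosed F = ∀ {A B} → A ∈ F → B ∈ F → (A ∪ B) ∈F F

UnionClosedFor : Family → Family → Set
UnionClosedFor F Fc = UnionClosed F × (∀ {A B} → A ∈ F → B ∈ Fc → (A ∪ B) ∈F F)

uce : Family → Family → Set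
uce Fc F = Distinct F × (∀ {A x} → A ∈ F → x ∈ A → x ∈⋃ Fc) × UnionClosedFor F Fc

_⊆F_ : Family → Family → Set
Fc ⊆F F = ∀ {B} → B ∈ Fc → B ∈F F

FC-family : Family → Set
FC-family Fc = ∀ (F : Family) → Distinct F → UnionClosed F → Fc ⊆F F →
  ∃ λ a → a ∈⋃ Fc × (card F ≤ 2 * cnt a F)

nonFC-family : Family → Set
nonFC-family Fc = ¬ FC-family Fc

Σℤ : ∀ {n} → (Fin n → ℤ) → ℤ
Σℤ {n} f = foldr ℤ._+_ (+ 0) (map f (allFin n))

excess : ℕ → Family → ℤ
excess a F = (+ (2 * cnt a F)) ℤ.- (+ card F)

-- Suppose Fc were an FC-family. Glue N·c_i copies of every F_i, with N larger than a
-- bound depending on Fc alone, into one union-closed family F ⊇ Fc. Give the j-th copy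
-- the tag Full ∖ {y_j}, where Full = {m, y_1, …, y_n} consists of fresh elements: unions
-- inside a copy stay in it because F_i is union-closed for Fc, unions across copies
-- contain Full, and the marker m keeps the copies away from Fc. Closing up with all
-- B ∪ Full (B ⊆ ⋃Fc) and with Fc adds a number of sets independent of N. For a ∈ ⋃Fc
-- the copies contribute N · Σ c_i (2 cnt(a,F_i) − |F_i|) ≤ −N to 2 cnt(a,F) − |F|, which
-- the closure cannot compensate, so no a ∈ ⋃Fc lies in half of the members of F.
module Submission where

open import Defs
open import Data.Empty using (⊥-elim)
open import Data.Fin using (Fin; toℕ)
import Data.Fin.Properties as Finₚ
open import Data.Integer as ℤ using (+_)
import Data.Integer.Properties as ℤ
open import Data.Integer.Solver using (module +-*-Solver)
open import Data.Nat using (ℕ; zero; suc; _≤_; _<_; _+_; _*_; _∸_; s≤s; z≤n; z<s)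
open import Data.Nat.ListAction using (sum)
open import Data.Nat.ListAction.Properties using (sum-++)
open import Data.Nat.Properties
open import Data.List using (List; []; _∷_; [_]; length; filter; _++_; map; foldr; concat; concatMap;
  replicate; lookup; allFin; deduplicate)
open import Data.List.Extrema.Nat using (max; xs≤max)
open import Data.List.Membership.DecPropositional _≟_ using (_∈?_)
open import Data.List.Membership.Propositional using (_∈_; _∉_; find)
open import Data.List.Membership.Propositional.Properties
  using (∈-++⁺ˡ; ∈-++⁺ʳ; ∈-++⁻; ∈-map⁺; ∈-map⁻; ∈-filter⁺; ∈-filter⁻; ∈-concat⁺; ∈-concat⁺′;
    ∈-concatMap⁺; ∈-concatMap⁻; ∈-lookup; ∈-allFin; ∈-deduplicate⁻)
open import Data.List.Properties using (length-++; length-map; length-filter; filter-++; filter-accept;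
  filter-reject; length-deduplicate; map-++; map-cong; map-tabulate; tabulate-lookup)
open import Data.List.Relation.Binary.Disjoint.Propositional using (Disjoint)
open import Data.List.Relation.Binary.Subset.DecPropositional _≟_ using (_⊆_; _⊆?_)
open import Data.List.Relation.Binary.Subset.Propositional.Properties
  using (⊆-refl; ⊆-trans; xs⊆xs++ys; xs⊆ys++xs; ++⁺)
open import Data.List.Relation.Unary.All as All using (All; []; _∷_)
open import Data.List.Relation.Unary.All.Properties as All using (replicate⁺; tabulate⁺)
open import Data.List.Relation.Unary.AllPairs as AllPairs using (AllPairs; []; _∷_)
import Data.List.Relation.Unary.AllPairs.Properties as AllPairs
open import Data.List.Relation.Unary.Any as Any using (Any; here; there)
open import Data.List.Relation.Unary.Any.Properties as Any using ()
open import Data.List.Relation.Unary.Unique.DecSetoid.Properties using (deduplicate-!)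
open import Data.List.Relation.Unary.Unique.Propositional.Properties using (allFin⁺)
open import Data.Product using (∃; _×_; _,_; proj₁; proj₂; uncurry)
open import Data.Sum as Sum using (_⊎_; inj₁; inj₂)
open import Function using (_∘_; id)
open import Relation.Binary using (IsEquivalence; DecSetoid; Decidable)
open import Relation.Binary.PropositionalEquality
  using (_≡_; _≢_; refl; sym; trans; cong; cong₂; subst; subst₂; module ≡-Reasoning)
open import Relation.Nullary using (¬_; Dec; yes; no; ¬?; contradiction)
open import Relation.Nullary.Decidable as Dec using (_×-dec_)

private
  variable
    A B C D X Z t : FSet

⊆-antisym : A ⊆ B → B ⊆ A → A ≐ B
⊆-antisym A⊆B B⊆A x = A⊆B , B⊆A

≐⇒⊆ : A ≐ B → A ⊆ B
≐⇒⊆ A≐B = proj₁ (A≐B _)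

≐-isEquivalence : IsEquivalence _≐_
≐-isEquivalence = record
  { refl  = λ x → id , id
  ; sym   = λ A≐B x → proj₂ (A≐B x) , proj₁ (A≐B x)
  ; trans = λ A≐B B≐C x → proj₁ (B≐C x) ∘ proj₁ (A≐B x) , proj₂ (A≐B x) ∘ proj₂ (B≐C x)
  }

open IsEquivalence ≐-isEquivalence using ()
  renaming (refl to ≐-refl; sym to ≐-sym; trans to ≐-trans)

_≐?_ : Decidable _≐_
A ≐? B = Dec.map′ (uncurry ⊆-antisym) (λ A≐B → ≐⇒⊆ A≐B , ≐⇒⊆ (≐-sym A≐B)) (A ⊆? B ×-dec B ⊆? A)

≐-decSetoid : DecSetoid _ _
≐-decSetoid = record { isDecEquivalence = record { isEquivalence = ≐-isEquivalence ; _≟_ = _≐?_ } }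

∪-⊆ : A ⊆ C → B ⊆ C → A ∪ B ⊆ C
∪-⊆ {A} A⊆C B⊆C x∈A∪B with ∈-++⁻ A x∈A∪B
... | inj₁ x∈A = A⊆C x∈A
... | inj₂ x∈B = B⊆C x∈B

∪-comm : (A B : FSet) → (A ∪ B) ≐ (B ∪ A)
∪-comm A B = ⊆-antisym (∪-⊆ (xs⊆ys++xs A B) (xs⊆xs++ys B A)) (∪-⊆ (xs⊆ys++xs B A) (xs⊆xs++ys A B))

∪-tagged : ∀ {B′} → (A ∪ B) ≐ D → B ⊆ B′ → B′ ⊆ B ∪ t → ((A ∪ t) ∪ B′) ≐ (D ∪ t)
∪-tagged {A} {B} {D} {t} {B′} A∪B≐D B⊆B′ B′⊆B∪t = ⊆-antisym
  (∪-⊆ (++⁺ (A∪B⊆D ∘ xs⊆xs++ys A B) ⊆-refl) (⊆-trans B′⊆B∪t (++⁺ (A∪B⊆D ∘ xs⊆ys++xs B A) ⊆-refl)))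
  (∪-⊆ (⊆-trans (≐⇒⊆ (≐-sym A∪B≐D)) (∪-⊆ A⊆ (xs⊆ys++xs B′ (A ∪ t) ∘ B⊆B′)))
       (xs⊆xs++ys (A ∪ t) B′ ∘ xs⊆ys++xs t A))
  where
  A∪B⊆D : A ∪ B ⊆ D
  A∪B⊆D = ≐⇒⊆ A∪B≐D
  A⊆ : A ⊆ (A ∪ t) ∪ B′
  A⊆ = xs⊆xs++ys (A ∪ t) B′ ∘ xs⊆xs++ys A t

∪-cancelʳ : ∀ {V} → Disjoint V t → A ⊆ V → B ⊆ V → (A ∪ t) ≐ (B ∪ t) → A ≐ B
∪-cancelʳ {t = t} {V = V} V#t A⊆V B⊆V A∪t≐B∪t = ⊆-antisym (cancel A⊆V A∪t≐B∪t) (cancel B⊆V (≐-sym A∪t≐B∪t))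
  where
  cancel : ∀ {A B} → A ⊆ V → (A ∪ t) ≐ (B ∪ t) → A ⊆ B
  cancel {A} {B} A⊆V A∪t≐B∪t x∈A with ∈-++⁻ B (≐⇒⊆ A∪t≐B∪t (xs⊆xs++ys A t x∈A))
  ... | inj₁ x∈B = x∈B
  ... | inj₂ x∈t = ⊥-elim (V#t (A⊆V x∈A , x∈t))

≐-restrict : ∀ {U V} → X ⊆ U ∪ V → V ⊆ X → X ≐ (filter (_∈? X) U ∪ V)
≐-restrict {X} {U} {V} X⊆U∪V V⊆X = ⊆-antisym split (∪-⊆ (proj₂ ∘ ∈-filter⁻ (_∈? X) {xs = U}) V⊆X)
  where
  split : X ⊆ filter (_∈? X) U ∪ V
  split x∈X with ∈-++⁻ U (X⊆U∪V x∈X)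
  ... | inj₁ x∈U = xs⊆xs++ys _ V (∈-filter⁺ (_∈? X) x∈U x∈X)
  ... | inj₂ x∈V = xs⊆ys++xs V _ x∈V

∈F-resp-≐ : ∀ {F} → X ≐ Z → Z ∈F F → X ∈F F
∈F-resp-≐ X≐Z = Any.map (≐-trans X≐Z)

∈⇒∈F : ∀ {F} → X ∈ F → X ∈F F
∈⇒∈F = Any.map λ { refl → ≐-refl }

∈F-deduplicate⁺ : ∀ {F} → X ∈F F → X ∈F deduplicate _≐?_ F
∈F-deduplicate⁺ = Any.deduplicate⁺ _≐?_ λ Z≐Y X≐Y → ≐-trans X≐Y (≐-sym Z≐Y)

map-∪-distinct : ∀ {V F} → Disjoint V t → All (_⊆ V) F → Distinct F → Distinct (map (_∪ t) F)
map-∪-distinct V#t []                []            = []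
map-∪-distinct {t = t} {V = V} {F = A ∷ _} V#t (A⊆V ∷ F⊆V) (A≉F ∷ F-distinct) =
  All.map⁺ (All.zipWith apart (F⊆V , A≉F)) ∷ map-∪-distinct V#t F⊆V F-distinct
  where
  apart : ∀ {B} → B ⊆ V × ¬ A ≐ B → ¬ (A ∪ t) ≐ (B ∪ t)
  apart (B⊆V , A≉B) = A≉B ∘ ∪-cancelʳ V#t A⊆V B⊆V

subsets : List ℕ → List FSet
subsets []       = [ [] ]
subsets (x ∷ xs) = subsets xs ++ map (x ∷_) (subsets xs)

filter-∈-subsets : ∀ {P : ℕ → Set} (P? : ∀ x → Dec (P x)) xs → filter P? xs ∈ subsets xs
filter-∈-subsets P? []       = here refl
filter-∈-subsets P? (x ∷ xs) with P? x
... | yes _ = ∈-++⁺ʳ (subsets xs) (∈-map⁺ (x ∷_) (filter-∈-subsets P? xs))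
... | no _  = ∈-++⁺ˡ (filter-∈-subsets P? xs)

∈-subsets⇒⊆ : ∀ xs → B ∈ subsets xs → B ⊆ xs
∈-subsets⇒⊆ []       (here refl) ()
∈-subsets⇒⊆ (x ∷ xs) B∈ y∈B with ∈-++⁻ (subsets xs) B∈
... | inj₁ B∈′ = there (∈-subsets⇒⊆ xs B∈′ y∈B)
... | inj₂ B∈′ with ∈-map⁻ (x ∷_) B∈′
... | B′ , B′∈ , refl with y∈B
... | here y≡x  = here y≡x
... | there y∈B′ = there (∈-subsets⇒⊆ xs B′∈ y∈B′)

cnt-++ : ∀ a F G → cnt a (F ++ G) ≡ cnt a F + cnt a G
cnt-++ a F G = trans (cong length (filter-++ (a ∈?_) F G)) (length-++ (filter (a ∈?_) F))

cnt-concatMap : ∀ {I : Set} a (f : I → Family) is → cnt a (concatMap f is) ≡ sum (map (cnt a ∘ f) is)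
cnt-concatMap a f []       = refl
cnt-concatMap a f (i ∷ is) = trans (cnt-++ a (f i) (concatMap f is)) (cong (_+_ (cnt a (f i))) (cnt-concatMap a f is))

length-concatMap : ∀ {I : Set} (f : I → Family) is → length (concatMap f is) ≡ sum (map (length ∘ f) is)
length-concatMap f []       = refl
length-concatMap f (i ∷ is) = trans (length-++ (f i)) (cong (_+_ (length (f i))) (length-concatMap f is))

cnt-map-∪ : ∀ {a} F → a ∉ t → cnt a (map (_∪ t) F) ≡ cnt a F
cnt-map-∪ [] a∉t = refl
cnt-map-∪ {t} {a} (A ∷ F) a∉t with a ∈? A
... | yes a∈A = trans (cong length (filter-accept (a ∈?_) (xs⊆xs++ys A t a∈A))) (cong suc (cnt-map-∪ F a∉t))
... | no a∉A  = trans (cong length (filter-reject (a ∈?_) a∉A∪t)) (cnt-map-∪ F a∉t)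
  where
  a∉A∪t : a ∉ A ∪ t
  a∉A∪t = Sum.[ a∉A , a∉t ] ∘ ∈-++⁻ A

map-lookup-allFin : ∀ {A B : Set} (f : A → B) (xs : List A) → map (f ∘ lookup xs) (allFin (length xs)) ≡ map f xs
map-lookup-allFin f xs = trans (map-tabulate id (f ∘ lookup xs)) (trans (sym (map-tabulate (lookup xs) f))
  (cong (map f) (tabulate-lookup xs)))

sum-map-*ˡ : ∀ {A : Set} k (f : A → ℕ) xs → sum (map (λ x → k * f x) xs) ≡ k * sum (map f xs)
sum-map-*ˡ k f []       = sym (*-zeroʳ k)
sum-map-*ˡ k f (x ∷ xs) = trans (cong (_+_ (k * f x)) (sum-map-*ˡ k f xs)) (sym (*-distribˡ-+ k (f x) _))

p+q≤2[c+d]⇒p≤2c+d : ∀ {p q c d} → d ≤ q → p + q ≤ 2 * (c + d) → p ≤ 2 * c + d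
p+q≤2[c+d]⇒p≤2c+d {p} {q} {c} {d} d≤q p+q≤2[c+d] = +-cancelʳ-≤ q p (2 * c + d) (begin
  p + q             ≤⟨ p+q≤2[c+d] ⟩
  2 * (c + d)       ≡⟨ *-distribˡ-+ 2 c d ⟩
  2 * c + 2 * d     ≡⟨ cong (λ e → 2 * c + (d + e)) (+-identityʳ d) ⟩
  2 * c + (d + d)   ≡⟨ +-assoc (2 * c) d d ⟨
  2 * c + d + d     ≤⟨ +-monoʳ-≤ (2 * c + d) d≤q ⟩
  2 * c + d + q     ∎)
  where open ≤-Reasoning

slack : Family → ℕ
slack Fc = length (subsets (concat Fc)) + length Fc

module Gluing (Fc : Family) (ucFc : UnionClosed Fc) (Gs : List Family) (uceGs : All (uce Fc) Gs) where

  U : FSet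
  U = concat Fc

  n : ℕ
  n = length Gs

  G : Fin n → Family
  G = lookup Gs

  marker : ℕ
  marker = suc (max 0 U)

  fresh : Fin n → ℕ
  fresh j = marker + suc (toℕ j)

  Full : FSet
  Full = marker ∷ map fresh (allFin n)

  tag : Fin n → FSet
  tag j = filter (λ x → ¬? (x ≟ fresh j)) Full

  copy : Fin n → Family
  copy j = map (_∪ tag j) (G j)

  P : Family
  P = concatMap copy (allFin n)

  H : Family
  H = map (_∪ Full) (subsets U)

  Q : Family
  Q = deduplicate _≐?_ (H ++ Fc)

  F : Family
  F = P ++ Q

  Fc-⊆U : A ∈ Fc → A ⊆ U
  Fc-⊆U A∈Fc x∈A = ∈-concat⁺′ x∈A A∈Fc

  G-⊆U : ∀ j → A ∈ G j → A ⊆ U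
  G-⊆U j A∈G = ∈-concat⁺ ∘ proj₁ (proj₂ (All.lookup uceGs (∈-lookup j))) A∈G

  G-∪-closed : ∀ j → A ∈ G j → B ∈ G j → (A ∪ B) ∈F G j
  G-∪-closed j = proj₁ (proj₂ (proj₂ (All.lookup uceGs (∈-lookup j))))

  G-∪-Fc : ∀ j → A ∈ G j → C ∈ Fc → (A ∪ C) ∈F G j
  G-∪-Fc j = proj₂ (proj₂ (proj₂ (All.lookup uceGs (∈-lookup j))))

  G-distinct : ∀ j → Distinct (G j)
  G-distinct j = proj₁ (All.lookup uceGs (∈-lookup j))

  U<marker : ∀ {x} → x ∈ U → x < marker
  U<marker x∈U = s≤s (All.lookup (xs≤max 0 U) x∈U)

  marker≤Full : ∀ {x} → x ∈ Full → marker ≤ x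
  marker≤Full (here refl) = ≤-refl
  marker≤Full (there x∈) with ∈-map⁻ fresh x∈
  ... | j , _ , refl = m≤m+n marker _

  U#Full : Disjoint U Full
  U#Full (x∈U , x∈Full) = <⇒≱ (U<marker x∈U) (marker≤Full x∈Full)

  fresh-injective : ∀ {i j} → fresh i ≡ fresh j → i ≡ j
  fresh-injective = Finₚ.toℕ-injective ∘ suc-injective ∘ +-cancelˡ-≡ marker _ _

  fresh∈Full : ∀ j → fresh j ∈ Full
  fresh∈Full j = there (∈-map⁺ fresh (∈-allFin j))

  tag⊆Full : ∀ j → tag j ⊆ Full
  tag⊆Full j = proj₁ ∘ ∈-filter⁻ (λ x → ¬? (x ≟ fresh j)) {xs = Full}

  fresh∉tag : ∀ j → fresh j ∉ tag j
  fresh∉tag j x∈ = proj₂ (∈-filter⁻ (λ x → ¬? (x ≟ fresh j)) {xs = Full} x∈) refl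

  ∈-tag : ∀ {x} j → x ∈ Full → x ≢ fresh j → x ∈ tag j
  ∈-tag j = ∈-filter⁺ (λ x → ¬? (x ≟ fresh j))

  marker∈tag : ∀ j → marker ∈ tag j
  marker∈tag j = ∈-tag j (here refl) (<⇒≢ (m<m+n marker z<s))

  Full⊆tag∪tag : ∀ {i j} → i ≢ j → Full ⊆ tag i ∪ tag j
  Full⊆tag∪tag {i} {j} i≢j {x} x∈Full with x ≟ fresh i
  ... | no x≢fresh-i = xs⊆xs++ys (tag i) (tag j) (∈-tag i x∈Full x≢fresh-i)
  ... | yes refl     = xs⊆ys++xs (tag j) (tag i) (∈-tag j x∈Full (i≢j ∘ fresh-injective))

  fresh∉copy : ∀ j → A ∈ G j → fresh j ∉ A ∪ tag j
  fresh∉copy {A} j A∈G x∈ with ∈-++⁻ A x∈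
  ... | inj₁ x∈A = U#Full (G-⊆U j A∈G x∈A , fresh∈Full j)
  ... | inj₂ x∈t = fresh∉tag j x∈t

  ∈P⁺ : ∀ j → A ∈ G j → (A ∪ tag j) ∈ P
  ∈P⁺ j A∈G = ∈-concatMap⁺ copy (Any.tabulate⁺ j (∈-map⁺ (_∪ tag j) A∈G))

  ∈P⁻ : X ∈ P → ∃ λ j → ∃ λ A → A ∈ G j × X ≡ A ∪ tag j
  ∈P⁻ X∈P with Any.satisfied (∈-concatMap⁻ copy {xs = allFin n} X∈P)
  ... | j , X∈copy = j , ∈-map⁻ (_∪ tag j) X∈copy

  ∈Q⁻ : X ∈ Q → (∃ λ B → B ⊆ U × X ≡ B ∪ Full) ⊎ X ∈ Fc
  ∈Q⁻ {X} X∈Q with ∈-++⁻ H (∈-deduplicate⁻ _≐?_ (H ++ Fc) X∈Q)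
  ... | inj₂ X∈Fc = inj₂ X∈Fc
  ... | inj₁ X∈H with ∈-map⁻ (_∪ Full) X∈H
  ... | B , B∈ , X≡ = inj₁ (B , ∈-subsets⇒⊆ U B∈ , X≡)

  data Member (X : FSet) : Set where
    copied : ∀ j {A} → A ∈ G j → X ≡ A ∪ tag j → Member X
    full   : Full ⊆ X → X ⊆ U ∪ Full → Member X
    core   : X ∈ Fc → Member X

  member : X ∈ F → Member X
  member X∈F with ∈-++⁻ P X∈F
  ... | inj₁ X∈P with ∈P⁻ X∈P
  ...   | j , A , A∈G , X≡ = copied j A∈G X≡
  member X∈F | inj₂ X∈Q with ∈Q⁻ X∈Q
  ...   | inj₁ (B , B⊆U , refl) = full (xs⊆ys++xs Full B) (++⁺ B⊆U ⊆-refl)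
  ...   | inj₂ X∈Fc = core X∈Fc

  member-⊆ : Member X → X ⊆ U ∪ Full
  member-⊆ (copied j A∈G refl) = ++⁺ (G-⊆U j A∈G) (tag⊆Full j)
  member-⊆ (full _ X⊆)         = X⊆
  member-⊆ (core X∈Fc)         = xs⊆xs++ys U Full ∘ Fc-⊆U X∈Fc

  copy-∈F : ∀ j → D ∈ G j → X ≐ (D ∪ tag j) → X ∈F F
  copy-∈F j D∈G X≐ = Any.++⁺ˡ (∈F-resp-≐ X≐ (∈⇒∈F (∈P⁺ j D∈G)))

  full-∈F : Full ⊆ X → X ⊆ U ∪ Full → X ∈F F
  full-∈F {X} Full⊆X X⊆ = Any.++⁺ʳ P (∈F-deduplicate⁺ (Any.++⁺ˡ (∈F-resp-≐ (≐-restrict X⊆ Full⊆X)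
    (∈⇒∈F (∈-map⁺ (_∪ Full) (filter-∈-subsets (_∈? X) U))))))

  Fc-∈F : X ∈F Fc → X ∈F F
  Fc-∈F = Any.++⁺ʳ P ∘ ∈F-deduplicate⁺ ∘ Any.++⁺ʳ H

  copy-∪-core : ∀ j → A ∈ G j → C ∈ Fc → ((A ∪ tag j) ∪ C) ∈F F
  copy-∪-core {C = C} j A∈ C∈Fc with find (G-∪-Fc j A∈ C∈Fc)
  ... | D , D∈ , A∪C≐D = copy-∈F j D∈ (∪-tagged A∪C≐D ⊆-refl (xs⊆xs++ys C (tag j)))

  ∪-member : Member X → Member Z → (X ∪ Z) ∈F F
  ∪-member {X} {Z} (full Full⊆X X⊆) mZ = full-∈F (xs⊆xs++ys X Z ∘ Full⊆X) (∪-⊆ X⊆ (member-⊆ mZ))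
  ∪-member {X} {Z} mX (full Full⊆Z Z⊆) = full-∈F (xs⊆ys++xs Z X ∘ Full⊆Z) (∪-⊆ (member-⊆ mX) Z⊆)
  ∪-member (copied i {A} A∈ refl) (copied j {B} B∈ refl) with i Finₚ.≟ j
  ... | yes refl with find (G-∪-closed i A∈ B∈)
  ...   | D , D∈ , A∪B≐D = copy-∈F i D∈ (∪-tagged A∪B≐D (xs⊆xs++ys B (tag i)) ⊆-refl)
  ∪-member mX@(copied i {A} _ refl) mZ@(copied j {B} _ refl) | no i≢j = full-∈F
    (⊆-trans (Full⊆tag∪tag i≢j) (++⁺ (xs⊆ys++xs (tag i) A) (xs⊆ys++xs (tag j) B)))
    (∪-⊆ (member-⊆ mX) (member-⊆ mZ))
  ∪-member (copied j A∈ refl) (core C∈Fc) = copy-∪-core j A∈ C∈Fc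
  ∪-member {X} {Z} (core C∈Fc) (copied j A∈ refl) = ∈F-resp-≐ (∪-comm X Z) (copy-∪-core j A∈ C∈Fc)
  ∪-member (core C∈Fc) (core C′∈Fc) = Fc-∈F (ucFc C∈Fc C′∈Fc)

  F-∪-closed : UnionClosed F
  F-∪-closed X∈F Z∈F = ∪-member (member X∈F) (member Z∈F)

  Fc⊆F : Fc ⊆F F
  Fc⊆F = Fc-∈F ∘ ∈⇒∈F

  copies-apart : ∀ {i j} → i ≢ j → A ∈ G i → B ∈ G j → ¬ (A ∪ tag i) ≐ (B ∪ tag j)
  copies-apart {B = B} {i} {j} i≢j A∈ B∈ A∪tag≐B∪tag = fresh∉copy i A∈
    (≐⇒⊆ (≐-sym A∪tag≐B∪tag) (xs⊆ys++xs (tag j) B (∈-tag j (fresh∈Full i) (i≢j ∘ fresh-injective))))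

  copy-distinct : ∀ j → Distinct (copy j)
  copy-distinct j = map-∪-distinct (λ (x∈U , x∈tag) → U#Full (x∈U , tag⊆Full j x∈tag))
    (All.tabulate (G-⊆U j)) (G-distinct j)

  P-distinct : Distinct P
  P-distinct = AllPairs.concat⁺ (All.map⁺ (tabulate⁺ copy-distinct))
    (AllPairs.map⁺ (AllPairs.map all-copies-apart (allFin⁺ n)))
    where
    all-copies-apart : ∀ {i j} → i ≢ j → All (λ X → All (λ Y → ¬ X ≐ Y) (copy j)) (copy i)
    all-copies-apart i≢j =
      All.map⁺ (All.tabulate λ A∈ → All.map⁺ (All.tabulate λ B∈ → copies-apart i≢j A∈ B∈))

  P≉Q : X ∈ P → Z ∈ Q → ¬ X ≐ Z
  P≉Q X∈P Z∈Q X≐Z with ∈P⁻ X∈P | ∈Q⁻ Z∈Q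
  ... | j , A , A∈ , refl | inj₁ (B , _ , refl) =
    fresh∉copy j A∈ (≐⇒⊆ (≐-sym X≐Z) (xs⊆ys++xs Full B (fresh∈Full j)))
  ... | j , A , A∈ , refl | inj₂ Z∈Fc =
    U#Full (Fc-⊆U Z∈Fc (≐⇒⊆ X≐Z (xs⊆ys++xs (tag j) A (marker∈tag j))) , here refl)

  F-distinct : Distinct F
  F-distinct = AllPairs.++⁺ P-distinct (deduplicate-! ≐-decSetoid (H ++ Fc))
    (All.tabulate λ X∈P → All.tabulate λ Z∈Q → P≉Q X∈P Z∈Q)

  cnt-P : ∀ {a} → a ∈ U → cnt a P ≡ sum (map (cnt a) Gs)
  cnt-P {a} a∈U = begin
    cnt a P                              ≡⟨ cnt-concatMap a copy (allFin n) ⟩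
    sum (map (cnt a ∘ copy) (allFin n))  ≡⟨ cong sum (map-cong a-uncounted-in-tag (allFin n)) ⟩
    sum (map (cnt a ∘ G) (allFin n))     ≡⟨ cong sum (map-lookup-allFin (cnt a) Gs) ⟩
    sum (map (cnt a) Gs)                 ∎
    where
    open ≡-Reasoning
    a-uncounted-in-tag : ∀ j → cnt a (copy j) ≡ cnt a (G j)
    a-uncounted-in-tag j = cnt-map-∪ (G j) (λ a∈tag → U#Full (a∈U , tag⊆Full j a∈tag))

  card-P : card P ≡ sum (map card Gs)
  card-P = begin
    length P                              ≡⟨ length-concatMap copy (allFin n) ⟩
    sum (map (length ∘ copy) (allFin n))  ≡⟨ cong sum (map-cong copy-length (allFin n)) ⟩
    sum (map (length ∘ G) (allFin n))     ≡⟨ cong sum (map-lookup-allFin length Gs) ⟩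
    sum (map length Gs)                   ∎
    where
    open ≡-Reasoning
    copy-length : ∀ j → length (copy j) ≡ length (G j)
    copy-length j = length-map (_∪ tag j) (G j)

  card-Q : card Q ≤ slack Fc
  card-Q = ≤-trans (length-deduplicate _≐?_ (H ++ Fc))
    (≤-reflexive (trans (length-++ H) (cong (_+ length Fc) (length-map (_∪ Full) (subsets U)))))

  nearly-balanced : ∀ {a} → a ∈⋃ Fc → card F ≤ 2 * cnt a F →
    sum (map card Gs) ≤ sum (map (λ E → 2 * cnt a E) Gs) + slack Fc
  nearly-balanced {a} a∈⋃Fc F-balanced = begin
    sum (map card Gs)                            ≡⟨ card-P ⟨
    card P                                       ≤⟨ p+q≤2[c+d]⇒p≤2c+d {c = cnt a P} cnt≤card F-balanced′ ⟩
    2 * cnt a P + cnt a Q                        ≤⟨ +-monoʳ-≤ (2 * cnt a P) (≤-trans cnt≤card card-Q) ⟩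
    2 * cnt a P + slack Fc                       ≡⟨ cong (_+ slack Fc) twice-cnt-P ⟩
    sum (map (λ E → 2 * cnt a E) Gs) + slack Fc  ∎
    where
    open ≤-Reasoning
    cnt≤card : cnt a Q ≤ card Q
    cnt≤card = length-filter (a ∈?_) Q
    F-balanced′ : card P + card Q ≤ 2 * (cnt a P + cnt a Q)
    F-balanced′ = subst₂ _≤_ (length-++ P) (cong (2 *_) (cnt-++ a P Q)) F-balanced
    twice-cnt-P : 2 * cnt a P ≡ sum (map (λ E → 2 * cnt a E) Gs)
    twice-cnt-P = trans (cong (2 *_) (cnt-P (∈-concat⁺ a∈⋃Fc))) (sym (sum-map-*ˡ 2 (cnt a) Gs))

FC-family⇒nearly-balanced : ∀ {Fc} → UnionClosed Fc → FC-family Fc → (Gs : List Family) → All (uce Fc) Gs →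
  ∃ λ a → a ∈⋃ Fc × sum (map card Gs) ≤ sum (map (λ E → 2 * cnt a E) Gs) + slack Fc
FC-family⇒nearly-balanced {Fc} ucFc isFC Gs uceGs =
  let a , a∈⋃Fc , F-balanced = isFC F F-distinct F-∪-closed Fc⊆F
  in a , a∈⋃Fc , nearly-balanced a∈⋃Fc F-balanced
  where open Gluing Fc ucFc Gs uceGs

sum-map-replicate : ∀ {A : Set} (h : A → ℕ) m x → sum (map h (replicate m x)) ≡ m * h x
sum-map-replicate h zero    x = refl
sum-map-replicate h (suc m) x = cong (_+_ (h x)) (sum-map-replicate h m x)

sum-map-concatMap-replicate : ∀ {I A : Set} (h : A → ℕ) (m : I → ℕ) (x : I → A) is →
  sum (map h (concatMap (λ i → replicate (m i) (x i)) is)) ≡ sum (map (λ i → m i * h (x i)) is)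
sum-map-concatMap-replicate h m x []       = refl
sum-map-concatMap-replicate h m x (i ∷ is) = begin
  sum (map h (xᵢs ++ rest))                  ≡⟨ cong sum (map-++ h xᵢs rest) ⟩
  sum (map h xᵢs ++ map h rest)              ≡⟨ sum-++ (map h xᵢs) (map h rest) ⟩
  sum (map h xᵢs) + sum (map h rest)         ≡⟨ cong₂ _+_ (sum-map-replicate h (m i) (x i))
                                                          (sum-map-concatMap-replicate h m x is) ⟩
  m i * h (x i) + sum (map (λ i → m i * h (x i)) is) ∎
  where
  open ≡-Reasoning
  xᵢs rest : List _
  xᵢs  = replicate (m i) (x i)
  rest = concatMap (λ i → replicate (m i) (x i)) is

[1+m]*c+m<[1+m]*l : ∀ m {c l} → c < l → suc m * c + m < suc m * l
[1+m]*c+m<[1+m]*l m {c} {l} c<l = begin-strict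
  suc m * c + m      <⟨ +-monoʳ-< (suc m * c) (n<1+n m) ⟩
  suc m * c + suc m  ≡⟨ +-comm (suc m * c) (suc m) ⟩
  suc m + suc m * c  ≡⟨ *-suc (suc m) c ⟨
  suc m * suc c      ≤⟨ *-monoʳ-≤ (suc m) c<l ⟩
  suc m * l          ∎
  where open ≤-Reasoning

Σℤ-weighted-difference : ∀ {I : Set} (c x y : I → ℕ) is →
  foldr ℤ._+_ (+ 0) (map (λ i → + c i ℤ.* (+ x i ℤ.- + y i)) is)
    ≡ + sum (map (λ i → c i * x i) is) ℤ.- + sum (map (λ i → c i * y i) is)
Σℤ-weighted-difference c x y []       = refl
Σℤ-weighted-difference c x y (i ∷ is) = begin
  + c i ℤ.* (+ x i ℤ.- + y i) ℤ.+ foldr ℤ._+_ (+ 0) (map (λ i → + c i ℤ.* (+ x i ℤ.- + y i)) is)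
    ≡⟨ cong (ℤ._+_ (+ c i ℤ.* (+ x i ℤ.- + y i))) (Σℤ-weighted-difference c x y is) ⟩
  + c i ℤ.* (+ x i ℤ.- + y i) ℤ.+ (+ Σx ℤ.- + Σy)
    ≡⟨ solve 5 (λ c x y X Y → c :* (x :- y) :+ (X :- Y) := (c :* x :+ X) :- (c :* y :+ Y))
         refl (+ c i) (+ x i) (+ y i) (+ Σx) (+ Σy) ⟩
  (+ c i ℤ.* + x i ℤ.+ + Σx) ℤ.- (+ c i ℤ.* + y i ℤ.+ + Σy)
    ≡⟨ cong₂ ℤ._-_ (pos-weighted x Σx) (pos-weighted y Σy) ⟩
  + (c i * x i + Σx) ℤ.- + (c i * y i + Σy) ∎
  where
  open ≡-Reasoning
  open +-*-Solver
  Σx Σy : ℕ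
  Σx = sum (map (λ i → c i * x i) is)
  Σy = sum (map (λ i → c i * y i) is)
  pos-weighted : (z : _ → ℕ) (Σz : ℕ) → + c i ℤ.* + z i ℤ.+ + Σz ≡ + (c i * z i + Σz)
  pos-weighted z Σz = trans (cong (ℤ._+ + Σz) (sym (ℤ.pos-* (c i) (z i)))) (sym (ℤ.pos-+ (c i * z i) Σz))

+m-+n<0⇒m<n : ∀ {m n} → + m ℤ.- + n ℤ.< + 0 → m < n
+m-+n<0⇒m<n {m} {n} m-n<0 with m <? n
... | yes m<n = m<n
... | no  m≮n = contradiction (ℤ.+≤+ z≤n) (ℤ.<⇒≱ (subst (ℤ._< + 0) m-n≡m∸n m-n<0))
  where
  m-n≡m∸n : + m ℤ.- + n ≡ + (m ∸ n)
  m-n≡m∸n = trans (ℤ.[+m]-[+n]≡m⊖n m n) (ℤ.⊖-≥ (≮⇒≥ m≮n))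

theorem2 : (Fc : Family) → Distinct Fc → UnionClosed Fc →
    (k : ℕ) (Fs : Fin (suc k) → Family) (c : Fin (suc k) → ℕ) →
    (∀ i → uce Fc (Fs i)) →
    (∀ a → a ∈⋃ Fc → Σℤ (λ i → (+ c i) ℤ.* excess a (Fs i)) ℤ.< + 0) →
    (∃ λ i → 0 < c i) →
    nonFC-family Fc
theorem2 Fc _ ucFc k Fs c uceFs excess<0 _ isFC =
  let a , a∈⋃Fc , balanced = FC-family⇒nearly-balanced ucFc isFC Gs uce-Gs
  in <⇒≱ ([1+m]*c+m<[1+m]*l (slack Fc) (deficit a a∈⋃Fc))
         (subst₂ _≤_ (replicas-sum card) (cong (_+ slack Fc) (replicas-sum (λ E → 2 * cnt a E))) balanced)
  where
  N : ℕ
  N = suc (slack Fc)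

  weighted : (Family → ℕ) → ℕ
  weighted h = sum (map (λ i → c i * h (Fs i)) (allFin (suc k)))

  Gs : List Family
  Gs = concatMap (λ i → replicate (N * c i) (Fs i)) (allFin (suc k))

  uce-Gs : All (uce Fc) Gs
  uce-Gs = All.concat⁺ (All.map⁺ (tabulate⁺ λ i → replicate⁺ (N * c i) (uceFs i)))

  replicas-sum : ∀ h → sum (map h Gs) ≡ N * weighted h
  replicas-sum h = trans (sum-map-concatMap-replicate h (λ i → N * c i) Fs (allFin (suc k)))
    (trans (cong sum (map-cong (λ i → *-assoc N (c i) (h (Fs i))) (allFin (suc k))))
           (sum-map-*ˡ N (λ i → c i * h (Fs i)) (allFin (suc k))))

  deficit : ∀ a → a ∈⋃ Fc → weighted (λ E → 2 * cnt a E) < weighted card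
  deficit a a∈⋃Fc = +m-+n<0⇒m<n
    (subst (ℤ._< + 0) (Σℤ-weighted-difference c _ _ (allFin (suc k))) (excess<0 a a∈⋃Fc))
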